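{- Every $4$-regular simple graph that is irreducible (admits no DP-removal) has the following structure: it is obtained by taking some number of vertex-disjoint copies of $K_5$, $K_5-e$ (the complete graph on $5$ vertices minus one edge) and $K_4$, and then adding a perfect matching on the set of vertices of degree $3$ in which every matched pair lies in two different copies.
   Context: For a $4$-regular simple graph $G$ (with no stub-edge), a DP-removal of a vertex $w$ consists of choosing two disjoint pairs of non-adjacent vertices among the four neighbors of $w$, adding these two pairs as edges, and deleting $w$ together with its incident edges. Equivalently, $w$ is DP-removable iff the complement of the subgraph induced by its neighborhood has a perfect matching. $G$ is irreducible if no vertex of $G$ is DP-removable. -}

module Defs where

open import Data.Nat using (ℕ; _<_; _≡ᵇ_)
open import Data.Bool using (Bool; true; false; not; _∧_; _∨_; if_then_else_)
open import Data.Fin using (Fin; _≟_)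
open import Data.List using (allFin; map)
open import Data.Nat.ListAction using (sum)
open import Data.Product using (Σ; ∃; _×_; _,_)
open import Relation.Nullary using (¬_; ⌊_⌋)
open import Relation.Binary.PropositionalEquality using (_≡_; _≢_)

Graph : ℕ → Set
Graph n = Fin n → Fin n → Bool

record IsSimple {n : ℕ} (G : Graph n) : Set where
  field
    symm  : ∀ u v → G u v ≡ G v u
    loopless : ∀ v → G v v ≡ false

deg : {n : ℕ} → Graph n → Fin n → ℕ
deg {n} G v = sum (map (λ u → if G v u then 1 else 0) (allFin n))

FourRegular : {n : ℕ} → Graph n → Set
FourRegular G = ∀ v → deg G v ≡ 4

-- DP-removal of w: choose two disjoint pairs {a,b}, {c,d} of non-adjacent
-- vertices among the four neighbours of w (four distinct neighbours, which
-- in a 4-regular graph are all the neighbours of w).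
DPRemovable : {n : ℕ} → Graph n → Fin n → Set
DPRemovable {n} G w =
  Σ (Fin n) λ a → Σ (Fin n) λ b → Σ (Fin n) λ c → Σ (Fin n) λ d →
    (G w a ≡ true × G w b ≡ true × G w c ≡ true × G w d ≡ true)
  × (a ≢ b × a ≢ c × a ≢ d × b ≢ c × b ≢ d × c ≢ d)
  × (G a b ≡ false × G c d ≡ false)

Irreducible : {n : ℕ} → Graph n → Set
Irreducible G = ∀ w → ¬ DPRemovable G w

data BlockType : Set where
  K5 K5-e K4 : BlockType

size : BlockType → ℕ
size K5   = 5
size K5-e = 5
size K4   = 4

blockAdj : BlockType → ℕ → ℕ → Bool
blockAdj K5   i j = not (i ≡ᵇ j)
blockAdj K5-e i j = not (i ≡ᵇ j) ∧ not (((i ≡ᵇ 0) ∧ (j ≡ᵇ 1)) ∨ ((i ≡ᵇ 1) ∧ (j ≡ᵇ 0)))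
blockAdj K4   i j = not (i ≡ᵇ j)

-- A decomposition of Fin n into k vertex-disjoint labelled copies:
-- vertex v lies in copy (blk v) with local label (loc v); (blk, loc) is a
-- bijection from Fin n onto { (b , i) | i < size (type b) }.
record Copies (n : ℕ) : Set where
  field
    k    : ℕ
    type : Fin k → BlockType
    blk  : Fin n → Fin k
    loc  : Fin n → ℕ
    loc<  : ∀ v → loc v < size (type (blk v))
    inj   : ∀ u v → blk u ≡ blk v → loc u ≡ loc v → u ≡ v
    surj  : ∀ (b : Fin k) (i : ℕ) → i < size (type b) →
            ∃ λ v → blk v ≡ b × loc v ≡ i

  H : Graph n
  H u v = ⌊ blk u ≟ blk v ⌋ ∧ blockAdj (type (blk u)) (loc u) (loc v)

ObtainedFromBlocks : {n : ℕ} → Graph n → Set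
ObtainedFromBlocks {n} G =
  Σ (Copies n) λ C → let open Copies C in
  Σ (Graph n) λ M →
      (∀ u v → M u v ≡ M v u)
    × (∀ u v → M u v ≡ true → blk u ≢ blk v)
    × (∀ v → deg H v ≡ 3 → deg M v ≡ 1)
    × (∀ v → deg H v ≢ 3 → deg M v ≡ 0)
    × (∀ u v → G u v ≡ (H u v ∨ M u v))

-- In an irreducible graph the complement of every neighbourhood N(v) has no perfect matching, so
-- the graph induced on N(v) meets each of the three perfect matchings of N(v); hence it contains a
-- triangle or a star, and a star centred at a makes one of its leaves DP-removable. Examining how the
-- fourth neighbour of v attaches to such a triangle, every configuration either makes a nearby vertex
-- DP-removable or yields a copy of K5, K5 − e or K4 through v that is closed: two of its vertices have
-- no common neighbour outside it. Each vertex of a block has at least three neighbours in it, so by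
-- 4-regularity two blocks through a vertex v share two neighbours of v, and closedness then forces
-- them to coincide. Hence the blocks partition the vertex set, and the remaining edges give every
-- vertex 4 − (its degree in its block) ∈ {0, 1} further neighbours in other blocks.

module Submission where

open import Algebra.Properties.CommutativeSemigroup using (interchange)
open import Data.Bool using (Bool; true; false; not; _∧_; _∨_; if_then_else_; T)
open import Data.Bool.Properties using (∧-zeroʳ; ∧-identityʳ; ∧-inverseʳ; not-injective; T-≡)
open import Data.Fin using (Fin; zero; suc; _≟_; toℕ; fromℕ<)
open import Data.Fin.Properties using (all?; any?; toℕ-injective; toℕ<n; toℕ-fromℕ<)
open import Data.List using (List; []; _∷_; map; allFin; length; filter)
open import Data.List.Membership.Propositional.Properties using (∈-allFin)
open import Data.List.Properties using (length-map)
open import Data.List.Relation.Unary.All using (All; []; _∷_)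
import Data.List.Relation.Unary.All as All
import Data.List.Relation.Unary.All.Properties as All
open import Data.List.Relation.Unary.All.Properties using (¬Any⇒All¬; All¬⇒¬Any; all-filter)
open import Data.List.Relation.Unary.Any using (here; there)
open import Data.List.Relation.Unary.Unique.Propositional using (Unique; []; _∷_)
import Data.List.Relation.Unary.Unique.Propositional.Properties as Unique
open import Data.List.Relation.Unary.Unique.Propositional.Properties using (allFin⁺)
open import Data.Nat using (ℕ; zero; suc; _+_; _≤_; _<_; z≤n; s≤s; _≤?_; _≡ᵇ_) renaming (_≟_ to _≟ℕ_)
open import Data.Nat.ListAction using (sum)
open import Data.Nat.Properties
  using ( ≤-refl; ≤-reflexive; ≤-trans; ≤-antisym; <-irrefl; ≤∧≢⇒<; m≤n+m; m+n≤o⇒m≤o; ≡ᵇ⇒≡; ≡⇒≡ᵇ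
        ; +-identityʳ; +-commutativeSemigroup; +-mono-≤; +-monoˡ-≤; +-monoʳ-≤
        ; +-cancelˡ-≡; +-cancelˡ-≤; +-cancelʳ-≤; +-cancelˡ-<; module ≤-Reasoning)
open import Data.Product using (∃; _×_; _,_; proj₁; proj₂)
open import Data.Sum using (_⊎_; inj₁; inj₂)
open import Data.Vec as Vec using (Vec; []; _∷_)
open import Data.Vec.Membership.Propositional.Properties using (∈-lookup)
open import Data.Vec.Relation.Unary.All using ([]; _∷_) renaming (All to AllVec)
open import Data.Vec.Relation.Unary.All.Properties using (lookup⁺)
open import Data.Vec.Relation.Unary.AllPairs using ([]; _∷_) renaming (AllPairs to AllPairsVec)
open import Data.Vec.Relation.Unary.Any using (here; there; index)
open import Data.Vec.Relation.Unary.Any.Properties using (lookup-index)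
open import Data.Vec.Relation.Unary.Unique.Propositional using () renaming (Unique to UniqueVec)
open import Data.Vec.Relation.Unary.Unique.Propositional.Properties using (lookup-injective)
open import Data.Empty using (⊥; ⊥-elim)
open import Function.Base using (_∘_)
open import Function.Bundles using (Equivalence)
open import Relation.Nullary using (¬_; yes; no; does; ⌊_⌋; contradiction)
open import Relation.Nullary.Decidable using (T?; toWitness)
open import Relation.Binary.PropositionalEquality

open import Defs

∧-true : ∀ {a b} → a ∧ b ≡ true → a ≡ true × b ≡ true
∧-true {true} {true} _ = refl , refl

allPairs-lookup : ∀ {A : Set} {R : A → A → Set} → (∀ {x y} → R x y → R y x) →
                  ∀ {m} {xs : Vec A m} → AllPairsVec R xs → ∀ i j → i ≢ j → R (Vec.lookup xs i) (Vec.lookup xs j)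
allPairs-lookup R-sym (rx ∷ rxs) zero    zero    i≢j = contradiction refl i≢j
allPairs-lookup R-sym (rx ∷ rxs) zero    (suc j) _   = lookup⁺ rx j
allPairs-lookup R-sym (rx ∷ rxs) (suc i) zero    _   = R-sym (lookup⁺ rx i)
allPairs-lookup R-sym (rx ∷ rxs) (suc i) (suc j) i≢j = allPairs-lookup R-sym rxs i j λ i≡j → i≢j (cong suc i≡j)

-- Counting

module _ {A : Set} where

  countIn : List A → (A → Bool) → ℕ
  countIn xs f = sum (map (λ u → if f u then 1 else 0) xs)

  countIn-cong : ∀ xs {f g : A → Bool} → (∀ u → f u ≡ g u) → countIn xs f ≡ countIn xs g
  countIn-cong []       f≗g = refl
  countIn-cong (x ∷ xs) f≗g rewrite f≗g x = cong (_ +_) (countIn-cong xs f≗g)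

  countIn-split : ∀ xs (f g : A → Bool) →
                  countIn xs f ≡ countIn xs (λ u → f u ∧ g u) + countIn xs (λ u → f u ∧ not (g u))
  countIn-split []       f g = refl
  countIn-split (x ∷ xs) f g = begin
    ind (f x) + countIn xs f
      ≡⟨ cong₂ _+_ (ind-split (f x) (g x)) (countIn-split xs f g) ⟩
    (ind (f x ∧ g x) + ind (f x ∧ not (g x))) + (countIn xs _ + countIn xs _)
      ≡⟨ interchange +-commutativeSemigroup (ind (f x ∧ g x)) _ (countIn xs _) _ ⟩
    (ind (f x ∧ g x) + countIn xs _) + (ind (f x ∧ not (g x)) + countIn xs _) ∎
    where
    open ≡-Reasoning
    ind : Bool → ℕ
    ind b = if b then 1 else 0
    ind-split : ∀ a b → ind a ≡ ind (a ∧ b) + ind (a ∧ not b)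
    ind-split false b     = refl
    ind-split true  true  = refl
    ind-split true  false = refl

  countIn-mono : ∀ xs {f g : A → Bool} → (∀ u → f u ≡ true → g u ≡ true) → countIn xs f ≤ countIn xs g
  countIn-mono []       f⇒g = z≤n
  countIn-mono (x ∷ xs) {f} {g} f⇒g with f x in fx | g x in gx
  ... | false | _     = ≤-trans (countIn-mono xs f⇒g) (m≤n+m _ _)
  ... | true  | true  = s≤s (countIn-mono xs f⇒g)
  ... | true  | false = contradiction (trans (sym (f⇒g x fx)) gx) λ ()

  countIn-false : ∀ xs → countIn xs (λ _ → false) ≡ 0
  countIn-false []       = refl
  countIn-false (x ∷ xs) = countIn-false xs

  countIn-witness : ∀ xs (f : A → Bool) → 0 < countIn xs f → ∃ λ a → f a ≡ true
  countIn-witness (x ∷ xs) f pos with f x in fx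
  ... | true  = x , fx
  ... | false = countIn-witness xs f pos

module Counting (n : ℕ) where
  open import Data.List.Membership.Propositional using (_∈_; _∉_)
  open import Data.List.Membership.DecPropositional (_≟_ {n}) using (_∈?_)

  count : (Fin n → Bool) → ℕ
  count = countIn (allFin n)

  countIn-≟-∉ : ∀ {a : Fin n} {xs} → a ∉ xs → countIn xs (λ u → does (u ≟ a)) ≡ 0
  countIn-≟-∉ {a} {[]}     a∉xs = refl
  countIn-≟-∉ {a} {x ∷ xs} a∉x∷xs with x ≟ a
  ... | yes refl = contradiction (here refl) a∉x∷xs
  ... | no _     = countIn-≟-∉ (λ a∈xs → a∉x∷xs (there a∈xs))

  countIn-≟ : ∀ {a : Fin n} {xs} → Unique xs → a ∈ xs → countIn xs (λ u → does (u ≟ a)) ≡ 1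
  countIn-≟ {a} {x ∷ xs} (x∉xs ∷ _) a∈x∷xs with x ≟ a
  ... | yes refl = cong suc (countIn-≟-∉ (All¬⇒¬Any x∉xs))
  countIn-≟ {a} {x ∷ xs} (_ ∷ xs!) (here a≡x)  | no x≢a = contradiction (sym a≡x) x≢a
  countIn-≟ {a} {x ∷ xs} (_ ∷ xs!) (there a∈xs) | no x≢a = countIn-≟ xs! a∈xs

  count-∈ : ∀ {ys} → Unique ys → count (λ u → does (u ∈? ys)) ≡ length ys
  count-∈ {[]}     []           = countIn-false (allFin n)
  count-∈ {y ∷ ys} (y∉ys ∷ ys!) = begin
    count (λ u → does (u ∈? y ∷ ys))
      ≡⟨ countIn-split (allFin n) _ (λ u → does (u ≟ y)) ⟩
    count (λ u → does (u ∈? y ∷ ys) ∧ does (u ≟ y)) + count (λ u → does (u ∈? y ∷ ys) ∧ not (does (u ≟ y)))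
      ≡⟨ cong₂ _+_ (trans (countIn-cong (allFin n) at-y) (countIn-≟ (allFin⁺ n) (∈-allFin y)))
                   (trans (countIn-cong (allFin n) off-y) (count-∈ ys!)) ⟩
    suc (length ys) ∎
    where
    open ≡-Reasoning
    at-y : ∀ u → ((does (u ≟ y) ∨ does (u ∈? ys)) ∧ does (u ≟ y)) ≡ does (u ≟ y)
    at-y u with u ≟ y
    ... | yes _ = refl
    ... | no _  = ∧-zeroʳ _
    off-y : ∀ u → ((does (u ≟ y) ∨ does (u ∈? ys)) ∧ not (does (u ≟ y))) ≡ does (u ∈? ys)
    off-y u with u ≟ y
    ... | no _     = ∧-identityʳ _
    ... | yes refl with y ∈? ys
    ...   | yes y∈ys = contradiction y∈ys (All¬⇒¬Any y∉ys)
    ...   | no _     = refl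

  count-∧-∈ : ∀ {ys} (f : Fin n → Bool) → Unique ys → All (λ y → f y ≡ true) ys →
              count (λ u → f u ∧ does (u ∈? ys)) ≡ length ys
  count-∧-∈ {ys} f ys! f-ys = trans (countIn-cong (allFin n) f-on-ys) (count-∈ ys!)
    where
    f-on-ys : ∀ u → (f u ∧ does (u ∈? ys)) ≡ does (u ∈? ys)
    f-on-ys u with u ∈? ys
    ... | yes u∈ys = trans (∧-identityʳ _) (All.lookup f-ys u∈ys)
    ... | no _     = ∧-zeroʳ _

  length≤count : ∀ {ys} (f : Fin n → Bool) → Unique ys → All (λ y → f y ≡ true) ys → length ys ≤ count f
  length≤count f ys! f-ys =
    subst (_≤ count f) (count-∧-∈ f ys! f-ys) (countIn-mono (allFin n) λ u → proj₁ ∘ ∧-true {f u})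

  count-∧-∉>0 : ∀ {ys} (f : Fin n → Bool) → Unique ys → All (λ y → f y ≡ true) ys → length ys < count f →
                0 < count (λ u → f u ∧ not (does (u ∈? ys)))
  count-∧-∉>0 {ys} f ys! f-ys ys<f = +-cancelˡ-< (length ys) 0 outside (begin-strict
    length ys + 0                                 ≡⟨ +-identityʳ _ ⟩
    length ys                                     <⟨ ys<f ⟩
    count f                                       ≡⟨ countIn-split (allFin n) f (λ u → does (u ∈? ys)) ⟩
    count (λ u → f u ∧ does (u ∈? ys)) + outside  ≡⟨ cong (_+ outside) (count-∧-∈ f ys! f-ys) ⟩
    length ys + outside                           ∎)
    where
    open ≤-Reasoning
    outside : ℕ
    outside = count (λ u → f u ∧ not (does (u ∈? ys)))

  fresh : ∀ {ys} (f : Fin n → Bool) → Unique ys → All (λ y → f y ≡ true) ys → length ys < count f →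
          ∃ λ u → f u ≡ true × u ∉ ys
  fresh {ys} f ys! f-ys ys<f with countIn-witness (allFin n) _ (count-∧-∉>0 f ys! f-ys ys<f)
  ... | u , fu∧u∉ys with u ∈? ys
  ...   | no u∉ys = u , trans (sym (∧-identityʳ _)) fu∧u∉ys , u∉ys
  ...   | yes _   = contradiction (trans (sym (∧-zeroʳ _)) fu∧u∉ys) λ ()

  twoWitnesses : ∀ (f : Fin n → Bool) → 2 ≤ count f → ∃ λ p → ∃ λ q → p ≢ q × f p ≡ true × f q ≡ true
  twoWitnesses f 2≤f with fresh f [] [] (≤-trans (s≤s z≤n) 2≤f)
  ... | p , fp , _ with fresh f ([] ∷ []) (fp ∷ []) 2≤f
  ...   | q , fq , q∉[p] = p , q , (λ p≡q → q∉[p] (here (sym p≡q))) , fp , fq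

-- Block types

localNeighbours : (τ : BlockType) → Fin (size τ) → List (Fin (size τ))
localNeighbours τ i = filter (λ j → T? (blockAdj τ (toℕ i) (toℕ j))) (allFin (size τ))

localDegree≥3 : ∀ τ (i : Fin (size τ)) → 3 ≤ length (localNeighbours τ i)
localDegree≥3 K5   = toWitness {a? = all? λ i → 3 ≤? length (localNeighbours K5 i)} _
localDegree≥3 K5-e = toWitness {a? = all? λ i → 3 ≤? length (localNeighbours K5-e i)} _
localDegree≥3 K4   = toWitness {a? = all? λ i → 3 ≤? length (localNeighbours K4 i)} _

localDegree-K5 : ∀ i → length (localNeighbours K5 i) ≡ 4
localDegree-K5 = toWitness {a? = all? λ i → length (localNeighbours K5 i) ≟ℕ 4} _

localDegree-K5-e : ∀ (i : Fin 3) → length (localNeighbours K5-e (suc (suc i))) ≡ 4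
localDegree-K5-e = toWitness {a? = all? λ i → length (localNeighbours K5-e (suc (suc i))) ≟ℕ 4} _

≡ᵇ-refl : ∀ m → (m ≡ᵇ m) ≡ true
≡ᵇ-refl m = Equivalence.to T-≡ (≡⇒≡ᵇ m m refl)

blockAdj-irrefl : ∀ τ m → blockAdj τ m m ≡ false
blockAdj-irrefl K5   m rewrite ≡ᵇ-refl m = refl
blockAdj-irrefl K5-e m rewrite ≡ᵇ-refl m = refl
blockAdj-irrefl K4   m rewrite ≡ᵇ-refl m = refl

≢⇒not-≡ᵇ : ∀ {m n} → m ≢ n → not (m ≡ᵇ n) ≡ true
≢⇒not-≡ᵇ {m} {n} m≢n with m ≡ᵇ n in eq
... | false = refl
... | true  = contradiction (≡ᵇ⇒≡ m n (subst T (sym eq) _)) m≢n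

not-≡ᵇ-false : ∀ m n → not (m ≡ᵇ n) ≡ false → m ≡ n
not-≡ᵇ-false m n eq = ≡ᵇ⇒≡ m n (subst T (sym (not-injective eq)) _)

nonNeighbour-unique : ∀ τ {i j k} → i ≢ j → i ≢ k →
                      blockAdj τ i j ≡ false → blockAdj τ i k ≡ false → j ≡ k
nonNeighbour-unique K5 i≢j _ ij _ = contradiction (not-≡ᵇ-false _ _ ij) i≢j
nonNeighbour-unique K4 i≢j _ ij _ = contradiction (not-≡ᵇ-false _ _ ij) i≢j
nonNeighbour-unique K5-e {0} {0}            i≢j _   _  _  = contradiction refl i≢j
nonNeighbour-unique K5-e {0} {1}  {0}       _   i≢k _  _  = contradiction refl i≢k
nonNeighbour-unique K5-e {0} {1}  {1}       _   _   _  _  = refl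
nonNeighbour-unique K5-e {0} {1}  {suc (suc k)} _ _ _  ()
nonNeighbour-unique K5-e {0} {suc (suc j)}  _   _   () _
nonNeighbour-unique K5-e {1} {1}            i≢j _   _  _  = contradiction refl i≢j
nonNeighbour-unique K5-e {1} {0}  {1}       _   i≢k _  _  = contradiction refl i≢k
nonNeighbour-unique K5-e {1} {0}  {0}       _   _   _  _  = refl
nonNeighbour-unique K5-e {1} {0}  {suc (suc k)} _ _ _  ()
nonNeighbour-unique K5-e {1} {suc (suc j)}  _   _   () _
nonNeighbour-unique K5-e {suc (suc i)} {j} i≢j _ ij _ = contradiction (high j ij) i≢j
  where
  high : ∀ j → blockAdj K5-e (suc (suc i)) j ≡ false → suc (suc i) ≡ j
  high (suc (suc j)) ij = cong (λ m → suc (suc m)) (not-≡ᵇ-false i j (trans (sym (∧-identityʳ _)) ij))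

-- Neighbourhoods, blocks and the partition of a 4-regular graph

module FourRegularGraph {n : ℕ} (G : Graph n) (simple : IsSimple G) (regular : FourRegular G) where
  open Counting n
  open IsSimple simple
  open import Data.Vec.Membership.DecPropositional (_≟_ {n}) using (_∈_; _∈?_)

  adj-sym : ∀ {x y b} → G x y ≡ b → G y x ≡ b
  adj-sym {x} {y} Gxy = trans (symm y x) Gxy

  adj⇒≢ : ∀ {x y} → G x y ≡ true → x ≢ y
  adj⇒≢ {x} Gxy refl = contradiction (trans (sym Gxy) (loopless x)) λ ()

  adj≢nonadj : ∀ {p x y} → G p x ≡ true → G p y ≡ false → x ≢ y
  adj≢nonadj Gpx Gpy refl = contradiction (trans (sym Gpx) Gpy) λ ()

  record Nbhd (v a b c d : Fin n) : Set where
    constructor mkNbhd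
    field
      adj₁ : G v a ≡ true
      adj₂ : G v b ≡ true
      adj₃ : G v c ≡ true
      adj₄ : G v d ≡ true
      ≢₁₂ : a ≢ b
      ≢₁₃ : a ≢ c
      ≢₁₄ : a ≢ d
      ≢₂₃ : b ≢ c
      ≢₂₄ : b ≢ d
      ≢₃₄ : c ≢ d

    covers : ∀ {u} → G v u ≡ true → u ≡ a ⊎ u ≡ b ⊎ u ≡ c ⊎ u ≡ d
    covers {u} vu with u ≟ a | u ≟ b | u ≟ c | u ≟ d
    ... | yes u≡a | _       | _       | _       = inj₁ u≡a
    ... | no _    | yes u≡b | _       | _       = inj₂ (inj₁ u≡b)
    ... | no _    | no _    | yes u≡c | _       = inj₂ (inj₂ (inj₁ u≡c))
    ... | no _    | no _    | no _    | yes u≡d = inj₂ (inj₂ (inj₂ u≡d))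
    ... | no u≢a  | no u≢b  | no u≢c  | no u≢d  = contradiction five≤deg (<-irrefl (sym (regular v)))
      where
      five≤deg : 5 ≤ count (G v)
      five≤deg = length≤count (G v)
        ((u≢a ∷ u≢b ∷ u≢c ∷ u≢d ∷ []) ∷ (≢₁₂ ∷ ≢₁₃ ∷ ≢₁₄ ∷ []) ∷
         (≢₂₃ ∷ ≢₂₄ ∷ []) ∷ (≢₃₄ ∷ []) ∷ [] ∷ [])
        (vu ∷ adj₁ ∷ adj₂ ∷ adj₃ ∷ adj₄ ∷ [])

    nonadjacent : ∀ {u} → u ≢ a → u ≢ b → u ≢ c → u ≢ d → G v u ≡ false
    nonadjacent {u} u≢a u≢b u≢c u≢d with G v u in vu
    ... | false = refl
    ... | true with covers vu
    ...   | inj₁ u≡a                = contradiction u≡a u≢a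
    ...   | inj₂ (inj₁ u≡b)         = contradiction u≡b u≢b
    ...   | inj₂ (inj₂ (inj₁ u≡c))  = contradiction u≡c u≢c
    ...   | inj₂ (inj₂ (inj₂ u≡d))  = contradiction u≡d u≢d

  swap₁₂ : ∀ {v a b c d} → Nbhd v a b c d → Nbhd v b a c d
  swap₁₂ (mkNbhd va vb vc vd ab ac ad bc bd cd) = mkNbhd vb va vc vd (≢-sym ab) bc bd ac ad cd

  swap₂₃ : ∀ {v a b c d} → Nbhd v a b c d → Nbhd v a c b d
  swap₂₃ (mkNbhd va vb vc vd ab ac ad bc bd cd) = mkNbhd va vc vb vd ac ab ad (≢-sym bc) cd bd

  swap₃₄ : ∀ {v a b c d} → Nbhd v a b c d → Nbhd v a b d c
  swap₃₄ (mkNbhd va vb vc vd ab ac ad bc bd cd) = mkNbhd va vb vd vc ab ad ac bd bc (≢-sym cd)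

  swapPairs : ∀ {v a b c d} → Nbhd v a b c d → Nbhd v c d a b
  swapPairs (mkNbhd va vb vc vd ab ac ad bc bd cd) =
    mkNbhd vc vd va vb cd (≢-sym ac) (≢-sym bc) (≢-sym ad) (≢-sym bd) ab

  open Nbhd

  private
    Adjacent : Fin n → Fin n → Set
    Adjacent v u = G v u ≡ true

    extend : ∀ {v ys} → Unique ys → All (Adjacent v) ys → length ys < 4 →
             ∃ λ u → Unique (u ∷ ys) × All (Adjacent v) (u ∷ ys)
    extend {v} ys! v-ys ys<4 with fresh (G v) ys! v-ys (subst (_ <_) (sym (regular v)) ys<4)
    ... | u , vu , u∉ys = u , ¬Any⇒All¬ _ u∉ys ∷ ys! , vu ∷ v-ys

    listNbhd : ∀ {v a b c d} → Unique (a ∷ b ∷ c ∷ d ∷ []) → All (Adjacent v) (a ∷ b ∷ c ∷ d ∷ []) →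
               Nbhd v a b c d
    listNbhd ((ab ∷ ac ∷ ad ∷ []) ∷ (bc ∷ bd ∷ []) ∷ (cd ∷ []) ∷ [] ∷ []) (va ∷ vb ∷ vc ∷ vd ∷ []) =
      mkNbhd va vb vc vd ab ac ad bc bd cd

  nbhd : ∀ v → ∃ λ a → ∃ λ b → ∃ λ c → ∃ λ d → Nbhd v a b c d
  nbhd v with extend [] [] (s≤s z≤n)
  ... | a , a! , va with extend a! va (s≤s (s≤s z≤n))
  ... | b , b! , vb with extend b! vb (s≤s (s≤s (s≤s z≤n)))
  ... | c , c! , vc with extend c! vc ≤-refl
  ... | d , d! , vd = d , c , b , a , listNbhd d! vd

  completeNbhd₃ : ∀ {v p q r} → G v p ≡ true → G v q ≡ true → G v r ≡ true →
                  p ≢ q → p ≢ r → q ≢ r → ∃ λ s → Nbhd v p q r s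
  completeNbhd₃ vp vq vr p≢q p≢r q≢r
    with extend ((p≢q ∷ p≢r ∷ []) ∷ (q≢r ∷ []) ∷ [] ∷ []) (vp ∷ vq ∷ vr ∷ []) ≤-refl
  ... | s , s! , vs = s , swap₃₄ (swap₂₃ (swap₁₂ (listNbhd s! vs)))

  completeNbhd₂ : ∀ {v p q} → G v p ≡ true → G v q ≡ true → p ≢ q →
                  ∃ λ r → ∃ λ s → Nbhd v p q r s
  completeNbhd₂ vp vq p≢q with extend ((p≢q ∷ []) ∷ [] ∷ []) (vp ∷ vq ∷ []) (s≤s (s≤s (s≤s z≤n)))
  ... | r , (r≢p ∷ r≢q ∷ []) ∷ _ , vr ∷ _ with completeNbhd₃ vp vq vr p≢q (≢-sym r≢p) (≢-sym r≢q)
  ...   | s , N = r , s , N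

  record Embedding (τ : BlockType) : Set where
    field
      vertices : Vec (Fin n) (size τ)
      distinct : UniqueVec vertices
      induced  : ∀ i j → i ≢ j → G (Vec.lookup vertices i) (Vec.lookup vertices j) ≡ blockAdj τ (toℕ i) (toℕ j)

    inBlock : Fin n → Bool
    inBlock u = does (u ∈? vertices)

    label : ∀ {x} → x ∈ vertices → ℕ
    label x∈ = toℕ (index x∈)

    label-injective : ∀ {x y} (x∈ : x ∈ vertices) (y∈ : y ∈ vertices) → label x∈ ≡ label y∈ → x ≡ y
    label-injective x∈ y∈ eq = begin
      _                              ≡⟨ lookup-index x∈ ⟩
      Vec.lookup vertices (index x∈) ≡⟨ cong (Vec.lookup vertices) (toℕ-injective eq) ⟩
      Vec.lookup vertices (index y∈) ≡⟨ lookup-index y∈ ⟨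
      _                              ∎
      where open ≡-Reasoning

    index-unique : ∀ {x} (x∈ x∈′ : x ∈ vertices) → index x∈ ≡ index x∈′
    index-unique x∈ x∈′ = lookup-injective distinct _ _ (trans (sym (lookup-index x∈)) (lookup-index x∈′))

    adjacency : ∀ {x y} (x∈ : x ∈ vertices) (y∈ : y ∈ vertices) → G x y ≡ blockAdj τ (label x∈) (label y∈)
    adjacency {x} {y} x∈ y∈ with x ≟ y
    ... | yes refl = begin
      G x x                                  ≡⟨ loopless x ⟩
      false                                  ≡⟨ blockAdj-irrefl τ (label x∈) ⟨
      blockAdj τ (label x∈) (label x∈)       ≡⟨ cong (λ i → blockAdj τ (label x∈) (toℕ i)) (index-unique x∈ y∈) ⟩
      blockAdj τ (label x∈) (label y∈)       ∎
      where open ≡-Reasoning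
    ... | no x≢y =
      subst₂ (λ x y → G x y ≡ blockAdj τ (label x∈) (label y∈)) (sym (lookup-index x∈)) (sym (lookup-index y∈))
             (induced _ _ λ i≡j → x≢y (label-injective x∈ y∈ (cong toℕ i≡j)))

    inBlock⇒∈ : ∀ {u} → inBlock u ≡ true → u ∈ vertices
    inBlock⇒∈ {u} eq with u ∈? vertices
    ... | yes u∈ = u∈

    ∈⇒inBlock : ∀ {u} → u ∈ vertices → inBlock u ≡ true
    ∈⇒inBlock {u} u∈ with u ∈? vertices
    ... | yes _ = refl
    ... | no u∉ = contradiction u∈ u∉

    ∉⇒inBlock-false : ∀ {u} → ¬ u ∈ vertices → inBlock u ≡ false
    ∉⇒inBlock-false {u} u∉ with u ∈? vertices
    ... | yes u∈ = contradiction u∈ u∉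
    ... | no _   = refl

    localNeighbour-adjacent : ∀ {i j} → T (blockAdj τ (toℕ i) (toℕ j)) →
      (G (Vec.lookup vertices i) (Vec.lookup vertices j) ∧ inBlock (Vec.lookup vertices j)) ≡ true
    localNeighbour-adjacent {i} {j} adj = begin
      G (Vec.lookup vertices i) (Vec.lookup vertices j) ∧ inBlock (Vec.lookup vertices j)
        ≡⟨ cong (G (Vec.lookup vertices i) (Vec.lookup vertices j) ∧_) (∈⇒inBlock (∈-lookup j vertices)) ⟩
      G (Vec.lookup vertices i) (Vec.lookup vertices j) ∧ true ≡⟨ ∧-identityʳ _ ⟩
      G (Vec.lookup vertices i) (Vec.lookup vertices j)       ≡⟨ induced i j i≢j ⟩
      blockAdj τ (toℕ i) (toℕ j)                             ≡⟨ Equivalence.to T-≡ adj ⟩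
      true                                                   ∎
      where
      open ≡-Reasoning
      i≢j : i ≢ j
      i≢j refl = subst T (blockAdj-irrefl τ (toℕ i)) adj

    localDegree≤ : ∀ {x} (x∈ : x ∈ vertices) → length (localNeighbours τ (index x∈)) ≤ count (λ u → G x u ∧ inBlock u)
    localDegree≤ {x} x∈ = begin
      length (localNeighbours τ i)                            ≡⟨ length-map (Vec.lookup vertices) (localNeighbours τ i) ⟨
      length (map (Vec.lookup vertices) (localNeighbours τ i)) ≤⟨ length≤count _ distinct′ adjacent′ ⟩
      count (λ u → G (Vec.lookup vertices i) u ∧ inBlock u)  ≡⟨ cong (λ y → count (λ u → G y u ∧ inBlock u)) (lookup-index x∈) ⟨
      count (λ u → G x u ∧ inBlock u)                        ∎
      where
      open ≤-Reasoning
      i = index x∈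
      distinct′ : Unique (map (Vec.lookup vertices) (localNeighbours τ i))
      distinct′ = Unique.map⁺ (λ {j} {j′} → lookup-injective distinct j j′) (Unique.filter⁺ _ (allFin⁺ (size τ)))
      adjacent′ : All (λ y → (G (Vec.lookup vertices i) y ∧ inBlock y) ≡ true) (map (Vec.lookup vertices) (localNeighbours τ i))
      adjacent′ = All.map⁺ (All.map localNeighbour-adjacent (all-filter _ (allFin (size τ))))

    neighboursInBlock≥3 : ∀ {x} → x ∈ vertices → 3 ≤ count (λ u → G x u ∧ inBlock u)
    neighboursInBlock≥3 x∈ = ≤-trans (localDegree≥3 τ (index x∈)) (localDegree≤ x∈)

    saturated : ∀ {x w} (x∈ : x ∈ vertices) → length (localNeighbours τ (index x∈)) ≡ 4 →
                G x w ≡ true → w ∈ vertices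
    saturated {x} {w} x∈ degree≡4 xw with w ∈? vertices
    ... | yes w∈ = w∈
    ... | no w∉  = contradiction (begin
        5                      ≤⟨ +-mono-≤ inside≥4 outside≥1 ⟩
        count (λ u → G x u ∧ inBlock u) + count (λ u → G x u ∧ not (inBlock u)) ≡⟨ countIn-split (allFin n) (G x) inBlock ⟨
        count (G x)            ≡⟨ regular x ⟩
        4                      ∎) (<-irrefl refl)
      where
      open ≤-Reasoning
      inside≥4 : 4 ≤ count (λ u → G x u ∧ inBlock u)
      inside≥4 = subst (_≤ _) degree≡4 (localDegree≤ x∈)
      outside≥1 : 1 ≤ count (λ u → G x u ∧ not (inBlock u))
      outside≥1 = length≤count _ ([] ∷ []) (trans (cong (λ b → G x w ∧ not b) (∉⇒inBlock-false w∉)) (trans (∧-identityʳ _) xw) ∷ [])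

    label≢ : ∀ {x y} (x∈ : x ∈ vertices) (y∈ : y ∈ vertices) → x ≢ y → label x∈ ≢ label y∈
    label≢ x∈ y∈ x≢y eq = x≢y (label-injective x∈ y∈ eq)

    nonNeighbourInBlock-unique : ∀ {y a b} (y∈ : y ∈ vertices) (a∈ : a ∈ vertices) (b∈ : b ∈ vertices) →
      y ≢ a → y ≢ b → G y a ≡ false → G y b ≡ false → a ≡ b
    nonNeighbourInBlock-unique y∈ a∈ b∈ y≢a y≢b ya yb = label-injective a∈ b∈
      (nonNeighbour-unique τ (label≢ y∈ a∈ y≢a) (label≢ y∈ b∈ y≢b)
        (trans (sym (adjacency y∈ a∈)) ya) (trans (sym (adjacency y∈ b∈)) yb))

  Closed : ∀ {τ} → Embedding τ → Set
  Closed E = ∀ {x y w} → x ∈ vertices → y ∈ vertices → x ≢ y → G x w ≡ true → G y w ≡ true → w ∈ vertices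
    where open Embedding E

  record Block : Set where
    field
      type      : BlockType
      embedding : Embedding type
      closed    : Closed embedding
    open Embedding embedding public


  open Block

  commonNeighbours≥2 : ∀ (B B′ : Block) {v} → v ∈ vertices B → v ∈ vertices B′ →
                       2 ≤ count (λ u → (G v u ∧ inBlock B u) ∧ inBlock B′ u)
  commonNeighbours≥2 B B′ {v} v∈B v∈B′ = +-cancelʳ-≤ 1 2 common (begin
    3                                 ≤⟨ neighboursInBlock≥3 B v∈B ⟩
    count inB                         ≡⟨ countIn-split (allFin n) inB (inBlock B′) ⟩
    common + onlyB                    ≤⟨ +-monoʳ-≤ common onlyB≤1 ⟩
    common + 1                        ∎)
    where
    open ≤-Reasoning
    inB inB′ notB′ : Fin n → Bool
    inB u = G v u ∧ inBlock B u
    inB′ u = G v u ∧ inBlock B′ u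
    notB′ u = G v u ∧ not (inBlock B′ u)
    common onlyB : ℕ
    common = count (λ u → inB u ∧ inBlock B′ u)
    onlyB = count (λ u → inB u ∧ not (inBlock B′ u))
    notB′≤1 : count notB′ ≤ 1
    notB′≤1 = +-cancelˡ-≤ 3 (count notB′) 1 (begin
      3 + count notB′             ≤⟨ +-monoˡ-≤ (count notB′) (neighboursInBlock≥3 B′ v∈B′) ⟩
      count inB′ + count notB′    ≡⟨ countIn-split (allFin n) (G v) (inBlock B′) ⟨
      count (G v)                 ≡⟨ regular v ⟩
      4                           ∎)
    onlyB≤1 : onlyB ≤ 1
    onlyB≤1 = ≤-trans (countIn-mono (allFin n) dropB) notB′≤1
      where
      dropB : ∀ u → (inB u ∧ not (inBlock B′ u)) ≡ true → notB′ u ≡ true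
      dropB u eq with ∧-true {inB u} eq
      ... | vu∧u∈B , u∉B′ = cong₂ _∧_ (proj₁ (∧-true {G v u} vu∧u∈B)) u∉B′

  commonNeighbour-split : ∀ (B B′ : Block) {v u} → ((G v u ∧ inBlock B u) ∧ inBlock B′ u) ≡ true →
                          G v u ≡ true × u ∈ vertices B × u ∈ vertices B′
  commonNeighbour-split B B′ {v} {u} eq =
    let vu∧u∈B , u∈B′ = ∧-true {G v u ∧ inBlock B u} eq
        vu , u∈B = ∧-true {G v u} vu∧u∈B
    in vu , inBlock⇒∈ B u∈B , inBlock⇒∈ B′ u∈B′

  commonNeighbourPair : ∀ (B B′ : Block) {v} → v ∈ vertices B → v ∈ vertices B′ →
    ∃ λ p → ∃ λ q → p ≢ q × G v p ≡ true × G v q ≡ true ×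
                    p ∈ vertices B × p ∈ vertices B′ × q ∈ vertices B × q ∈ vertices B′
  commonNeighbourPair B B′ {v} v∈B v∈B′ =
    let p , q , p≢q , p-common , q-common = twoWitnesses _ (commonNeighbours≥2 B B′ v∈B v∈B′)
        vp , p∈B , p∈B′ = commonNeighbour-split B B′ p-common
        vq , q∈B , q∈B′ = commonNeighbour-split B B′ q-common
    in p , q , p≢q , vp , vq , p∈B , p∈B′ , q∈B , q∈B′

  shared⇒⊆ : ∀ (B B′ : Block) {v} → v ∈ vertices B → v ∈ vertices B′ → ∀ {y} → y ∈ vertices B → y ∈ vertices B′
  shared⇒⊆ B B′ {v} v∈B v∈B′ {y} y∈B = go (commonNeighbourPair B B′ v∈B v∈B′)
    where
    go : (∃ λ p → ∃ λ q → p ≢ q × G v p ≡ true × G v q ≡ true ×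
                          p ∈ vertices B × p ∈ vertices B′ × q ∈ vertices B × q ∈ vertices B′) → y ∈ vertices B′
    go (p , q , p≢q , vp , vq , p∈B , p∈B′ , q∈B , q∈B′) with y ≟ v | y ≟ p | y ≟ q
    ... | yes refl | _        | _        = v∈B′
    ... | no _     | yes refl | _        = p∈B′
    ... | no _     | no _     | yes refl = q∈B′
    ... | no y≢v   | no y≢p   | no y≢q with G y v in yv | G y p in yp | G y q in yq
    ...   | true  | true  | _     = closed B′ v∈B′ p∈B′ (adj⇒≢ vp) (adj-sym yv) (adj-sym yp)
    ...   | true  | false | true  = closed B′ v∈B′ q∈B′ (adj⇒≢ vq) (adj-sym yv) (adj-sym yq)
    ...   | false | true  | true  = closed B′ p∈B′ q∈B′ p≢q (adj-sym yp) (adj-sym yq)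
    ...   | false | false | _     = contradiction (nonNeighbourInBlock-unique B y∈B v∈B p∈B y≢v y≢p yv yp) (adj⇒≢ vp)
    ...   | false | true  | false = contradiction (nonNeighbourInBlock-unique B y∈B v∈B q∈B y≢v y≢q yv yq) (adj⇒≢ vq)
    ...   | true  | false | false = contradiction (nonNeighbourInBlock-unique B y∈B p∈B q∈B y≢p y≢q yp yq) p≢q

  cliqueInduced : ∀ {m} {vs : Vec (Fin n) m} → AllPairsVec (λ x y → G x y ≡ true) vs →
                  ∀ i j → i ≢ j → G (Vec.lookup vs i) (Vec.lookup vs j) ≡ not (toℕ i ≡ᵇ toℕ j)
  cliqueInduced clique i j i≢j =
    trans (allPairs-lookup adj-sym clique i j i≢j) (sym (≢⇒not-≡ᵇ (λ eq → i≢j (toℕ-injective eq))))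

  K5-block : ∀ {vs : Vec (Fin n) 5} → UniqueVec vs → AllPairsVec (λ x y → G x y ≡ true) vs → Block
  K5-block {vs} vs! clique = record
    { type      = K5
    ; embedding = E
    ; closed    = λ x∈ _ _ xw _ → Embedding.saturated E x∈ (localDegree-K5 (index x∈)) xw
    }
    where
    E : Embedding K5
    E = record { vertices = vs ; distinct = vs! ; induced = cliqueInduced clique }

  K5-e-block : ∀ {p q s₁ s₂ s₃} → G p q ≡ false →
               Nbhd s₁ p q s₂ s₃ → Nbhd s₂ p q s₁ s₃ → Nbhd s₃ p q s₁ s₂ →
               (∀ {w} → G p w ≡ true → G q w ≡ true → w ∈ (p ∷ q ∷ s₁ ∷ s₂ ∷ s₃ ∷ [])) → Block
  K5-e-block {p} {q} {s₁} {s₂} {s₃} pq N₁ N₂ N₃ pq-closed = record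
    { type      = K5-e
    ; embedding = E
    ; closed    = closure
    }
    where
    ps : AllVec (λ s → G p s ≡ true) (s₁ ∷ s₂ ∷ s₃ ∷ [])
    ps = adj-sym (adj₁ N₁) ∷ adj-sym (adj₁ N₂) ∷ adj-sym (adj₁ N₃) ∷ []
    qs : AllVec (λ s → G q s ≡ true) (s₁ ∷ s₂ ∷ s₃ ∷ [])
    qs = adj-sym (adj₂ N₁) ∷ adj-sym (adj₂ N₂) ∷ adj-sym (adj₂ N₃) ∷ []
    ss : AllPairsVec (λ x y → G x y ≡ true) (s₁ ∷ s₂ ∷ s₃ ∷ [])
    ss = (adj₃ N₁ ∷ adj₄ N₁ ∷ []) ∷ (adj₄ N₂ ∷ []) ∷ [] ∷ []
    adjacencies : ∀ i j → i ≢ j → G (Vec.lookup (p ∷ q ∷ s₁ ∷ s₂ ∷ s₃ ∷ []) i) (Vec.lookup (p ∷ q ∷ s₁ ∷ s₂ ∷ s₃ ∷ []) j)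
                              ≡ blockAdj K5-e (toℕ i) (toℕ j)
    adjacencies zero          zero          i≢j = contradiction refl i≢j
    adjacencies zero          (suc zero)    _   = pq
    adjacencies zero          (suc (suc j)) _   = lookup⁺ ps j
    adjacencies (suc zero)    zero          _   = adj-sym pq
    adjacencies (suc zero)    (suc zero)    i≢j = contradiction refl i≢j
    adjacencies (suc zero)    (suc (suc j)) _   = lookup⁺ qs j
    adjacencies (suc (suc i)) zero          _   = adj-sym (lookup⁺ ps i)
    adjacencies (suc (suc i)) (suc zero)    _   = adj-sym (lookup⁺ qs i)
    adjacencies (suc (suc i)) (suc (suc j)) i≢j =
      trans (cliqueInduced ss i j λ i≡j → i≢j (cong (λ k → suc (suc k)) i≡j)) (sym (∧-identityʳ _))
    E : Embedding K5-e
    E = record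
      { vertices = p ∷ q ∷ s₁ ∷ s₂ ∷ s₃ ∷ []
      ; distinct = (≢₁₂ N₁ ∷ ≢-sym (adj⇒≢ (adj₁ N₁)) ∷ ≢-sym (adj⇒≢ (adj₁ N₂)) ∷ ≢-sym (adj⇒≢ (adj₁ N₃)) ∷ [])
                 ∷ (≢-sym (adj⇒≢ (adj₂ N₁)) ∷ ≢-sym (adj⇒≢ (adj₂ N₂)) ∷ ≢-sym (adj⇒≢ (adj₂ N₃)) ∷ [])
                 ∷ (adj⇒≢ (adj₃ N₁) ∷ adj⇒≢ (adj₄ N₁) ∷ []) ∷ (adj⇒≢ (adj₄ N₂) ∷ []) ∷ [] ∷ []
      ; induced  = adjacencies
      }
    closure : Closed E
    closure (there (there x∈)) _ _ xw _ = Embedding.saturated E (there (there x∈)) (localDegree-K5-e (index x∈)) xw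
    closure _ (there (there y∈)) _ _ yw = Embedding.saturated E (there (there y∈)) (localDegree-K5-e (index y∈)) yw
    closure (here refl)         (here refl)         x≢y _  _  = contradiction refl x≢y
    closure (here refl)         (there (here refl)) _   pw qw = pq-closed pw qw
    closure (there (here refl)) (here refl)         _   qw pw = pq-closed pw qw
    closure (there (here refl)) (there (here refl)) x≢y _  _  = contradiction refl x≢y

  nbhd-exit : ∀ {x a b c o w} {S : Fin n → Set} → Nbhd x a b c o → S a → S b → S c → G x w ≡ true → S w ⊎ w ≡ o
  nbhd-exit {S = S} N Sa Sb Sc xw with Nbhd.covers N xw
  ... | inj₁ refl                = inj₁ Sa
  ... | inj₂ (inj₁ refl)         = inj₁ Sb
  ... | inj₂ (inj₂ (inj₁ refl))  = inj₁ Sc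
  ... | inj₂ (inj₂ (inj₂ w≡o))   = inj₂ w≡o

  K4-block : ∀ {a b c d oa ob oc od} → Nbhd a b c d oa → Nbhd b a c d ob → Nbhd c a b d oc → Nbhd d a b c od →
             UniqueVec (oa ∷ ob ∷ oc ∷ od ∷ []) → Block
  K4-block {a} {b} {c} {d} {oa} {ob} {oc} {od} Na Nb Nc Nd exits! = record
    { type      = K4
    ; embedding = E
    ; closed    = closure
    }
    where
    vs = a ∷ b ∷ c ∷ d ∷ []
    exits = oa ∷ ob ∷ oc ∷ od ∷ []
    E : Embedding K4
    E = record
      { vertices = vs
      ; distinct = (adj⇒≢ (adj₁ Na) ∷ adj⇒≢ (adj₂ Na) ∷ adj⇒≢ (adj₃ Na) ∷ []) ∷ (≢₁₂ Na ∷ ≢₁₃ Na ∷ []) ∷ (≢₂₃ Na ∷ []) ∷ [] ∷ []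
      ; induced  = cliqueInduced ((adj₁ Na ∷ adj₂ Na ∷ adj₃ Na ∷ []) ∷ (adj₂ Nb ∷ adj₃ Nb ∷ []) ∷ (adj₃ Nc ∷ []) ∷ [] ∷ [])
      }
    exit : ∀ {x w} (x∈ : x ∈ vs) → G x w ≡ true → w ∈ vs ⊎ w ≡ Vec.lookup exits (index x∈)
    exit (here refl)                         = nbhd-exit {S = _∈ vs} Na (there (here refl)) (there (there (here refl))) (there (there (there (here refl))))
    exit (there (here refl))                 = nbhd-exit {S = _∈ vs} Nb (here refl) (there (there (here refl))) (there (there (there (here refl))))
    exit (there (there (here refl)))         = nbhd-exit {S = _∈ vs} Nc (here refl) (there (here refl)) (there (there (there (here refl))))
    exit (there (there (there (here refl)))) = nbhd-exit {S = _∈ vs} Nd (here refl) (there (here refl)) (there (there (here refl)))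
    closure : Closed E
    closure x∈ y∈ x≢y xw yw with exit x∈ xw | exit y∈ yw
    ... | inj₁ w∈    | _          = w∈
    ... | inj₂ _     | inj₁ w∈    = w∈
    ... | inj₂ w≡ox  | inj₂ w≡oy  =
      contradiction (Embedding.label-injective E x∈ y∈ (cong toℕ (lookup-injective exits! _ _ (trans (sym w≡ox) w≡oy)))) x≢y

  record Cover (us : List (Fin n)) : Set where
    field
      k        : ℕ
      block    : Fin k → Block
      disjoint : ∀ {b b′ v} → v ∈ vertices (block b) → v ∈ vertices (block b′) → b ≡ b′
      covered  : All (λ u → ∃ λ b → u ∈ vertices (block b)) us

  module Partition (blockThrough : ∀ v → ∃ λ B → v ∈ vertices B) where

    extendCover : ∀ {u us} (C : Cover us) → ¬ (∃ λ b → u ∈ vertices (Cover.block C b)) → Cover (u ∷ us)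
    extendCover {u} C u∉C = record
      { k        = suc k
      ; block    = block′
      ; disjoint = disjoint′
      ; covered  = (zero , u∈B) ∷ All.map (λ (b , v∈b) → suc b , v∈b) covered
      }
      where
      open Cover C
      B : Block
      B = proj₁ (blockThrough u)
      u∈B : u ∈ vertices B
      u∈B = proj₂ (blockThrough u)
      block′ : Fin (suc k) → Block
      block′ zero    = B
      block′ (suc b) = block b
      apart : ∀ {b v} → v ∈ vertices B → ¬ v ∈ vertices (block b)
      apart {b} v∈B v∈b = u∉C (b , shared⇒⊆ B (block b) v∈B v∈b u∈B)
      disjoint′ : ∀ {b b′ v} → v ∈ vertices (block′ b) → v ∈ vertices (block′ b′) → b ≡ b′
      disjoint′ {zero}  {zero}   _   _    = refl
      disjoint′ {zero}  {suc _}  v∈  v∈′  = contradiction v∈′ (apart v∈)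
      disjoint′ {suc _} {zero}   v∈  v∈′  = contradiction v∈ (apart v∈′)
      disjoint′ {suc _} {suc _}  v∈  v∈′  = cong suc (disjoint v∈ v∈′)

    cover : ∀ us → Cover us
    cover []       = record { k = 0 ; block = λ () ; disjoint = λ { {()} } ; covered = [] }
    cover (u ∷ us) = step (cover us)
      where
      step : Cover us → Cover (u ∷ us)
      step C with any? (λ b → u ∈? vertices (Cover.block C b))
      ... | yes u∈C = record { Cover C ; covered = u∈C ∷ Cover.covered C }
      ... | no u∉C  = extendCover C u∉C

    open Cover (cover (allFin n))

    home : ∀ v → ∃ λ b → v ∈ vertices (block b)
    home v = All.lookup covered (∈-allFin v)

    blockOf : Fin n → Fin k
    blockOf v = proj₁ (home v)

    ∈blockOf : ∀ v → v ∈ vertices (block (blockOf v))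
    ∈blockOf v = proj₂ (home v)

    labelOf : Fin n → ℕ
    labelOf v = label (block (blockOf v)) (∈blockOf v)

    labelOf-injective : ∀ {u v} → blockOf u ≡ blockOf v → labelOf u ≡ labelOf v → u ≡ v
    labelOf-injective {u} {v} = go (∈blockOf u) (∈blockOf v)
      where
      go : ∀ {b b′} (u∈ : u ∈ vertices (block b)) (v∈ : v ∈ vertices (block b′)) →
           b ≡ b′ → label (block b) u∈ ≡ label (block b′) v∈ → u ≡ v
      go u∈ v∈ refl = label-injective (block _) u∈ v∈

    labelOf-lookup : ∀ {b i} → labelOf (Vec.lookup (vertices (block b)) i) ≡ toℕ i
    labelOf-lookup {b} {i} = go (∈blockOf _) (disjoint (∈blockOf _) (∈-lookup i (vertices (block b))))
      where
      go : ∀ {b′} (v∈ : Vec.lookup (vertices (block b)) i ∈ vertices (block b′)) → b′ ≡ b →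
           label (block b′) v∈ ≡ toℕ i
      go v∈ refl = cong toℕ (lookup-injective (distinct (block b)) _ _ (sym (lookup-index v∈)))

    copies : Copies n
    copies = record
      { k    = k
      ; type = λ b → type (block b)
      ; blk  = blockOf
      ; loc  = labelOf
      ; loc< = λ v → toℕ<n (index (∈blockOf v))
      ; inj  = λ u v → labelOf-injective
      ; surj = λ b i i< → Vec.lookup (vertices (block b)) (fromℕ< i<)
                        , disjoint (∈blockOf _) (∈-lookup (fromℕ< i<) (vertices (block b)))
                        , trans labelOf-lookup (toℕ-fromℕ< i<)
      }

    open Copies copies using (H)

    H-sameBlock : ∀ u v → H u v ≡ (⌊ blockOf u ≟ blockOf v ⌋ ∧ G u v)
    H-sameBlock u v with blockOf u ≟ blockOf v
    ... | no _    = refl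
    ... | yes eq = go (∈blockOf u) (∈blockOf v) eq
      where
      go : ∀ {b b′} (u∈ : u ∈ vertices (block b)) (v∈ : v ∈ vertices (block b′)) → b ≡ b′ →
           blockAdj (type (block b)) (label (block b) u∈) (label (block b′) v∈) ≡ G u v
      go u∈ v∈ refl = sym (adjacency (block _) u∈ v∈)

    H⇒G : ∀ {u v} → H u v ≡ true → G u v ≡ true
    H⇒G {u} {v} huv = proj₂ (∧-true {⌊ blockOf u ≟ blockOf v ⌋} (trans (sym (H-sameBlock u v)) huv))

    H-sym : ∀ u v → H u v ≡ H v u
    H-sym u v = begin
      H u v                                  ≡⟨ H-sameBlock u v ⟩
      ⌊ blockOf u ≟ blockOf v ⌋ ∧ G u v      ≡⟨ cong₂ _∧_ (≟-sym (blockOf u) (blockOf v)) (symm u v) ⟩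
      ⌊ blockOf v ≟ blockOf u ⌋ ∧ G v u      ≡⟨ H-sameBlock v u ⟨
      H v u                                  ∎
      where
      open ≡-Reasoning
      ≟-sym : ∀ (a b : Fin k) → ⌊ a ≟ b ⌋ ≡ ⌊ b ≟ a ⌋
      ≟-sym a b with a ≟ b | b ≟ a
      ... | yes _   | yes _   = refl
      ... | no _    | no _    = refl
      ... | yes a≡b | no b≢a  = contradiction (sym a≡b) b≢a
      ... | no a≢b  | yes b≡a = contradiction (sym b≡a) a≢b

    M : Graph n
    M u v = G u v ∧ not (H u v)

    M-sym : ∀ u v → M u v ≡ M v u
    M-sym u v = cong₂ (λ g h → g ∧ not h) (symm u v) (H-sym u v)

    M-cross : ∀ u v → M u v ≡ true → blockOf u ≢ blockOf v
    M-cross u v muv same = contradiction (trans (sym muv) G∧¬G) λ ()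
      where
      G∧¬G : M u v ≡ false
      G∧¬G with blockOf u ≟ blockOf v | H-sameBlock u v
      ... | yes _   | huv = trans (cong (λ h → G u v ∧ not h) huv) (∧-inverseʳ (G u v))
      ... | no diff | _   = contradiction same diff

    G≡H∨M : ∀ u v → G u v ≡ (H u v ∨ M u v)
    G≡H∨M u v with H u v in huv
    ... | true  = H⇒G huv
    ... | false = sym (∧-identityʳ (G u v))

    degH+degM : ∀ v → deg H v + deg M v ≡ 4
    degH+degM v = begin
      count (H v) + count (M v)                       ≡⟨ cong (_+ count (M v)) (countIn-cong (allFin n) G∧H≡H) ⟨
      count (λ u → G v u ∧ H v u) + count (M v)       ≡⟨ countIn-split (allFin n) (G v) (H v) ⟨
      count (G v)                                     ≡⟨ regular v ⟩
      4                                               ∎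
      where
      open ≡-Reasoning
      G∧H≡H : ∀ u → (G v u ∧ H v u) ≡ H v u
      G∧H≡H u with H v u in hvu
      ... | true  = trans (∧-identityʳ (G v u)) (H⇒G hvu)
      ... | false = ∧-zeroʳ (G v u)

    degH≥3 : ∀ v → 3 ≤ deg H v
    degH≥3 v = ≤-trans (neighboursInBlock≥3 (block (blockOf v)) (∈blockOf v)) (countIn-mono (allFin n) inH)
      where
      inH : ∀ u → (G v u ∧ inBlock (block (blockOf v)) u) ≡ true → H v u ≡ true
      inH u vu∧u∈ with ∧-true {G v u} vu∧u∈
      ... | vu , u∈ = trans (H-sameBlock v u) (cong₂ _∧_ same vu)
        where
        same : ⌊ blockOf v ≟ blockOf u ⌋ ≡ true
        same with blockOf v ≟ blockOf u
        ... | yes _    = refl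
        ... | no diff  = contradiction (sym (disjoint (∈blockOf u) (inBlock⇒∈ (block (blockOf v)) u∈))) diff

    obtainedFromBlocks : ObtainedFromBlocks G
    obtainedFromBlocks = copies , M , M-sym , M-cross , degM≡1 , degM≡0 , G≡H∨M
      where
      degM≡1 : ∀ v → deg H v ≡ 3 → deg M v ≡ 1
      degM≡1 v h≡3 = +-cancelˡ-≡ 3 (deg M v) 1 (trans (cong (_+ deg M v) (sym h≡3)) (degH+degM v))
      degM≡0 : ∀ v → deg H v ≢ 3 → deg M v ≡ 0
      degM≡0 v h≢3 = +-cancelˡ-≡ 4 (deg M v) 0 (trans (cong (_+ deg M v) (sym h≡4)) (degH+degM v))
        where
        h≡4 : deg H v ≡ 4
        h≡4 = ≤-antisym (m+n≤o⇒m≤o (deg H v) (≤-reflexive (degH+degM v))) (≤∧≢⇒< (degH≥3 v) (λ 3≡h → h≢3 (sym 3≡h)))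

  K5-case : ∀ {v x y z t} → Nbhd v x y z t → G x y ≡ true → G x z ≡ true → G y z ≡ true →
            G t x ≡ true → G t y ≡ true → G t z ≡ true → ∃ λ B → v ∈ vertices B
  K5-case (mkNbhd vx vy vz vt x≢y x≢z x≢t y≢z y≢t z≢t) xy xz yz tx ty tz =
    K5-block ((adj⇒≢ vx ∷ adj⇒≢ vy ∷ adj⇒≢ vz ∷ adj⇒≢ vt ∷ []) ∷ (x≢y ∷ x≢z ∷ x≢t ∷ []) ∷
              (y≢z ∷ y≢t ∷ []) ∷ (z≢t ∷ []) ∷ [] ∷ [])
             ((vx ∷ vy ∷ vz ∷ vt ∷ []) ∷ (xy ∷ xz ∷ adj-sym tx ∷ []) ∷
              (yz ∷ adj-sym ty ∷ []) ∷ (adj-sym tz ∷ []) ∷ [] ∷ []) ,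
    here refl

  -- Irreducible graphs

  module Irreducible (irreducible : Irreducible G) where

    noRemoval : ∀ {w a b c d} → Nbhd w a b c d → G a b ≡ false → G c d ≡ false → ⊥
    noRemoval (mkNbhd wa wb wc wd ab ac ad bc bd cd) a≁b c≁d =
      irreducible _ (_ , _ , _ , _ , (wa , wb , wc , wd) , (ab , ac , ad , bc , bd , cd) , (a≁b , c≁d))

    -- With r, s the remaining neighbours of w, the pairs {a, r} and {b, s} would be a DP-removal of w.
    noDetachedPair : ∀ {w a b} → G w a ≡ true → G w b ≡ true → a ≢ b →
                     (∀ {u} → G w u ≡ true → u ≢ a → u ≢ b → G a u ≡ false × G b u ≡ false) → ⊥
    noDetachedPair {w} {a} {b} wa wb a≢b detached = removal (proj₂ (proj₂ (completeNbhd₂ wa wb a≢b)))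
      where
      removal : ∀ {r s} → Nbhd w a b r s → ⊥
      removal N = noRemoval (swap₂₃ N)
        (proj₁ (detached (adj₃ N) (≢-sym (≢₁₃ N)) (≢-sym (≢₂₃ N))))
        (proj₂ (detached (adj₄ N) (≢-sym (≢₁₄ N)) (≢-sym (≢₂₄ N))))

    matchingEdge : ∀ {v a b c d} → Nbhd v a b c d → G a b ≡ true ⊎ G c d ≡ true
    matchingEdge {a = a} {b} {c} {d} N with G a b in ab | G c d in cd
    ... | true  | _     = inj₁ refl
    ... | false | true  = inj₂ refl
    ... | false | false = ⊥-elim (noRemoval N ab cd)

    record TriangleNbhd (v : Fin n) : Set where
      constructor triangleNbhd
      field
        x y z t : Fin n
        around  : Nbhd v x y z t
        xy      : G x y ≡ true
        xz      : G x z ≡ true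
        yz      : G y z ≡ true

    starDetached : ∀ {v a b c d} → Nbhd v a b c d → G a b ≡ true → G a c ≡ true → G a d ≡ true →
                   G b c ≡ false → G b d ≡ false → G c d ≡ false → ⊥
    starDetached {v} {a} {b} {c} {d} N ab ac ad bc bd cd =
      noDetachedPair (adj-sym (adj₂ N)) (adj-sym ab) (adj⇒≢ (adj₁ N)) detached
      where
      Na : Nbhd a v b c d
      Na = mkNbhd (adj-sym (adj₁ N)) ab ac ad (adj⇒≢ (adj₂ N)) (adj⇒≢ (adj₃ N)) (adj⇒≢ (adj₄ N)) (≢₂₃ N) (≢₂₄ N) (≢₃₄ N)
      detached : ∀ {u} → G b u ≡ true → u ≢ v → u ≢ a → G v u ≡ false × G a u ≡ false
      detached bu u≢v u≢a =
        nonadjacent N u≢a (≢-sym (adj⇒≢ bu)) (adj≢nonadj bu bc) (adj≢nonadj bu bd) ,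
        nonadjacent Na u≢v (≢-sym (adj⇒≢ bu)) (adj≢nonadj bu bc) (adj≢nonadj bu bd)

    star⇒triangle : ∀ {v a b c d} → Nbhd v a b c d → G a b ≡ true → G a c ≡ true → G a d ≡ true → TriangleNbhd v
    star⇒triangle {v} {a} {b} {c} {d} N ab ac ad with G b c in bc | G b d in bd | G c d in cd
    ... | true  | _     | _     = triangleNbhd _ _ _ _ N ab ac bc
    ... | false | true  | _     = triangleNbhd _ _ _ _ (swap₃₄ N) ab ad bd
    ... | false | false | true  = triangleNbhd _ _ _ _ (swap₃₄ (swap₂₃ N)) ac ad cd
    ... | false | false | false = ⊥-elim (starDetached N ab ac ad bc bd cd)

    edge⇒triangle : ∀ {v a b c d} → Nbhd v a b c d → G a b ≡ true → TriangleNbhd v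
    edge⇒triangle N ab with matchingEdge (swap₂₃ N) | matchingEdge (swap₂₃ (swap₃₄ N))
    ... | inj₁ ac | inj₁ ad = star⇒triangle N ab ac ad
    ... | inj₁ ac | inj₂ bc = triangleNbhd _ _ _ _ N ab ac bc
    ... | inj₂ bd | inj₁ ad = triangleNbhd _ _ _ _ (swap₃₄ N) ab ad bd
    ... | inj₂ bd | inj₂ bc = star⇒triangle (swap₁₂ N) (adj-sym ab) bc bd

    triangle : ∀ v → TriangleNbhd v
    triangle v = fromNbhd (proj₂ (proj₂ (proj₂ (proj₂ (nbhd v)))))
      where
      fromNbhd : ∀ {a b c d} → Nbhd v a b c d → TriangleNbhd v
      fromNbhd N with matchingEdge N
      ... | inj₁ ab = edge⇒triangle N ab
      ... | inj₂ cd = edge⇒triangle (swapPairs N) cd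

    K5-e-noOuterCommonNeighbour : ∀ {p q s₁ s₂ s₃} → Nbhd s₁ p q s₂ s₃ → Nbhd s₂ p q s₁ s₃ → Nbhd s₃ p q s₁ s₂ →
                                  ∀ {w} → G p w ≡ true → G q w ≡ true → w ≢ s₁ → w ≢ s₂ → w ≢ s₃ → ⊥
    K5-e-noOuterCommonNeighbour {p} {q} {s₁} {s₂} {s₃} N₁ N₂ N₃ {w} pw qw w≢s₁ w≢s₂ w≢s₃ =
      noDetachedPair (adj-sym pw) (adj-sym qw) (≢₁₂ N₁) detached
      where
      w≢p = ≢-sym (adj⇒≢ pw)
      w≢q = ≢-sym (adj⇒≢ qw)
      ws₁ = adj-sym (nonadjacent N₁ w≢p w≢q w≢s₂ w≢s₃)
      ws₂ = adj-sym (nonadjacent N₂ w≢p w≢q w≢s₁ w≢s₃)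
      ws₃ = adj-sym (nonadjacent N₃ w≢p w≢q w≢s₁ w≢s₂)
      s₁≢s₂ = adj⇒≢ (adj₃ N₁)
      s₁≢s₃ = adj⇒≢ (adj₄ N₁)
      s₂≢s₃ = adj⇒≢ (adj₄ N₂)
      Np : Nbhd p s₁ s₂ s₃ w
      Np = mkNbhd (adj-sym (adj₁ N₁)) (adj-sym (adj₁ N₂)) (adj-sym (adj₁ N₃)) pw
                  s₁≢s₂ s₁≢s₃ (≢-sym w≢s₁) s₂≢s₃ (≢-sym w≢s₂) (≢-sym w≢s₃)
      Nq : Nbhd q s₁ s₂ s₃ w
      Nq = mkNbhd (adj-sym (adj₂ N₁)) (adj-sym (adj₂ N₂)) (adj-sym (adj₂ N₃)) qw
                  s₁≢s₂ s₁≢s₃ (≢-sym w≢s₁) s₂≢s₃ (≢-sym w≢s₂) (≢-sym w≢s₃)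
      detached : ∀ {u} → G w u ≡ true → u ≢ p → u ≢ q → G p u ≡ false × G q u ≡ false
      detached wu _ _ =
        nonadjacent Np (adj≢nonadj wu ws₁) (adj≢nonadj wu ws₂) (adj≢nonadj wu ws₃) (≢-sym (adj⇒≢ wu)) ,
        nonadjacent Nq (adj≢nonadj wu ws₁) (adj≢nonadj wu ws₂) (adj≢nonadj wu ws₃) (≢-sym (adj⇒≢ wu))

    K5-e-commonNeighbours : ∀ {p q s₁ s₂ s₃} → Nbhd s₁ p q s₂ s₃ → Nbhd s₂ p q s₁ s₃ → Nbhd s₃ p q s₁ s₂ →
                            ∀ {w} → G p w ≡ true → G q w ≡ true → w ∈ (p ∷ q ∷ s₁ ∷ s₂ ∷ s₃ ∷ [])
    K5-e-commonNeighbours {s₁ = s₁} {s₂} {s₃} N₁ N₂ N₃ {w} pw qw with w ≟ s₁ | w ≟ s₂ | w ≟ s₃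
    ... | yes refl | _        | _        = there (there (here refl))
    ... | no _     | yes refl | _        = there (there (there (here refl)))
    ... | no _     | no _     | yes refl = there (there (there (there (here refl))))
    ... | no w≢s₁  | no w≢s₂  | no w≢s₃  = ⊥-elim (K5-e-noOuterCommonNeighbour N₁ N₂ N₃ pw qw w≢s₁ w≢s₂ w≢s₃)

    K5-e-case : ∀ {v x y z t} → Nbhd v x y z t → G x y ≡ true → G x z ≡ true → G y z ≡ true →
                G t x ≡ true → G t y ≡ true → G t z ≡ false → ∃ λ B → v ∈ vertices B
    K5-e-case {v} {x} {y} {z} {t} N xy xz yz tx ty tz =
      K5-e-block (adj-sym tz) N₁ N₂ N₃ (K5-e-commonNeighbours N₁ N₂ N₃) , there (there (here refl))
      where
      N₁ : Nbhd v z t x y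
      N₁ = swapPairs N
      N₂ : Nbhd x z t v y
      N₂ = mkNbhd xz (adj-sym tx) (adj-sym (adj₁ N)) xy
                  (≢₃₄ N) (≢-sym (adj⇒≢ (adj₃ N))) (≢-sym (≢₂₃ N)) (≢-sym (adj⇒≢ (adj₄ N))) (≢-sym (≢₂₄ N)) (adj⇒≢ (adj₂ N))
      N₃ : Nbhd y z t v x
      N₃ = mkNbhd yz (adj-sym ty) (adj-sym (adj₂ N)) (adj-sym xy)
                  (≢₃₄ N) (≢-sym (adj⇒≢ (adj₃ N))) (≢-sym (≢₁₃ N)) (≢-sym (adj⇒≢ (adj₄ N))) (≢-sym (≢₁₄ N)) (adj⇒≢ (adj₁ N))

    noSingleEdge : ∀ {v x y z t} → Nbhd v x y z t → G x y ≡ true → G x z ≡ true →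
                   G t x ≡ true → G t y ≡ false → G t z ≡ false → ⊥
    noSingleEdge {v} {x} {y} {z} {t} N xy xz tx ty tz =
      noDetachedPair (adj-sym (adj₄ N)) tx (adj⇒≢ (adj₁ N)) detached
      where
      Nx : Nbhd x v y z t
      Nx = mkNbhd (adj-sym (adj₁ N)) xy xz (adj-sym tx)
                  (adj⇒≢ (adj₂ N)) (adj⇒≢ (adj₃ N)) (adj⇒≢ (adj₄ N)) (≢₂₃ N) (≢₂₄ N) (≢₃₄ N)
      detached : ∀ {u} → G t u ≡ true → u ≢ v → u ≢ x → G v u ≡ false × G x u ≡ false
      detached tu u≢v u≢x =
        nonadjacent N u≢x (adj≢nonadj tu ty) (adj≢nonadj tu tz) (≢-sym (adj⇒≢ tu)) ,
        nonadjacent Nx u≢v (adj≢nonadj tu ty) (adj≢nonadj tu tz) (≢-sym (adj⇒≢ tu))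

    noSharedExit : ∀ {v x y z t s z′} → Nbhd v x y z t → G x t ≡ false →
                   Nbhd x v y z s → Nbhd y v x z s → Nbhd z v x y z′ → z′ ≢ s → ⊥
    noSharedExit {v} {x} {y} {z} {t} {s} N xt Nx Ny Nz z′≢s =
      noDetachedPair (adj-sym (adj₄ Nx)) (adj-sym (adj₄ Ny)) (≢₁₂ N) detached
      where
      s≢v = ≢-sym (≢₁₄ Nx)
      s≢x = ≢-sym (adj⇒≢ (adj₄ Nx))
      s≢y = ≢-sym (≢₂₄ Nx)
      sv : G s v ≡ false
      sv = adj-sym (nonadjacent N s≢x s≢y (≢-sym (≢₃₄ Nx)) (adj≢nonadj (adj₄ Nx) xt))
      sz : G s z ≡ false
      sz = adj-sym (nonadjacent Nz s≢v s≢x s≢y (≢-sym z′≢s))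
      detached : ∀ {u} → G s u ≡ true → u ≢ x → u ≢ y → G x u ≡ false × G y u ≡ false
      detached su u≢x u≢y =
        nonadjacent Nx (adj≢nonadj su sv) u≢y (adj≢nonadj su sz) (≢-sym (adj⇒≢ su)) ,
        nonadjacent Ny (adj≢nonadj su sv) u≢x (adj≢nonadj su sz) (≢-sym (adj⇒≢ su))

    sharedExit-case : ∀ {v x y z t s} → Nbhd v x y z t → G x t ≡ false →
                      Nbhd x v y z s → Nbhd y v x z s → Nbhd z v x y s → ∃ λ B → v ∈ vertices B
    sharedExit-case {v} {x} {y} {z} {t} {s} N xt Nx Ny Nz =
      K5-e-block v≁s N₁ N₂ N₃ (K5-e-commonNeighbours N₁ N₂ N₃) , here refl
      where
      N₁ : Nbhd x v s y z
      N₁ = swap₂₃ (swap₃₄ Nx)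
      N₂ : Nbhd y v s x z
      N₂ = swap₂₃ (swap₃₄ Ny)
      N₃ : Nbhd z v s x y
      N₃ = swap₂₃ (swap₃₄ Nz)
      v≁s : G v s ≡ false
      v≁s = nonadjacent N (≢-sym (adj⇒≢ (adj₄ Nx))) (≢-sym (≢₂₄ Nx)) (≢-sym (≢₃₄ Nx)) (adj≢nonadj (adj₄ Nx) xt)

    K4-case : ∀ {v x y z t x′ y′ z′} → Nbhd v x y z t → G x t ≡ false → G y t ≡ false → G z t ≡ false →
              Nbhd x v y z x′ → Nbhd y v x z y′ → Nbhd z v x y z′ →
              x′ ≢ y′ → x′ ≢ z′ → y′ ≢ z′ → ∃ λ B → v ∈ vertices B
    K4-case N xt yt zt Nx Ny Nz x′≢y′ x′≢z′ y′≢z′ =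
      K4-block N Nx Ny Nz ((t≢ Nx xt ∷ t≢ Ny yt ∷ t≢ Nz zt ∷ []) ∷ (x′≢y′ ∷ x′≢z′ ∷ []) ∷ (y′≢z′ ∷ []) ∷ [] ∷ []) ,
      here refl
      where
      t≢ : ∀ {a b c d e t} → Nbhd a b c d e → G a t ≡ false → t ≢ e
      t≢ Na at = ≢-sym (adj≢nonadj (adj₄ Na) at)

    exits-case : ∀ {v x y z t x′ y′ z′} → Nbhd v x y z t → G x t ≡ false → G y t ≡ false → G z t ≡ false →
                 Nbhd x v y z x′ → Nbhd y v x z y′ → Nbhd z v x y z′ → ∃ λ B → v ∈ vertices B
    exits-case {x′ = x′} {y′} {z′} N xt yt zt Nx Ny Nz with x′ ≟ y′ | x′ ≟ z′ | y′ ≟ z′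
    ... | yes refl | yes refl | _        = sharedExit-case N xt Nx Ny Nz
    ... | yes refl | no x′≢z′ | _        = ⊥-elim (noSharedExit N xt Nx Ny Nz (≢-sym x′≢z′))
    ... | no x′≢y′ | yes refl | _        = ⊥-elim (noSharedExit (swap₂₃ N) xt (swap₂₃ Nx) Nz Ny (≢-sym x′≢y′))
    ... | no x′≢y′ | no _     | yes refl = ⊥-elim (noSharedExit (swap₂₃ (swap₁₂ N)) yt (swap₂₃ Ny) (swap₂₃ Nz) Nx x′≢y′)
    ... | no x′≢y′ | no x′≢z′ | no y′≢z′ = K4-case N xt yt zt Nx Ny Nz x′≢y′ x′≢z′ y′≢z′

    isolated-case : ∀ {v x y z t} → Nbhd v x y z t → G x y ≡ true → G x z ≡ true → G y z ≡ true →
                    G t x ≡ false → G t y ≡ false → G t z ≡ false → ∃ λ B → v ∈ vertices B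
    isolated-case N xy xz yz tx ty tz = exits-case N (adj-sym tx) (adj-sym ty) (adj-sym tz)
      (proj₂ (completeNbhd₃ (adj-sym (adj₁ N)) xy xz v≢y v≢z (≢₂₃ N)))
      (proj₂ (completeNbhd₃ (adj-sym (adj₂ N)) (adj-sym xy) yz v≢x v≢z (≢₁₃ N)))
      (proj₂ (completeNbhd₃ (adj-sym (adj₃ N)) (adj-sym xz) (adj-sym yz) v≢x v≢y (≢₁₂ N)))
      where
      v≢x = adj⇒≢ (adj₁ N)
      v≢y = adj⇒≢ (adj₂ N)
      v≢z = adj⇒≢ (adj₃ N)

    blockThrough : ∀ v → ∃ λ B → v ∈ vertices B
    blockThrough v = fromTriangle (triangle v)
      where
      fromTriangle : TriangleNbhd v → ∃ λ B → v ∈ vertices B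
      fromTriangle (triangleNbhd x y z t N xy xz yz) with G t x in tx | G t y in ty | G t z in tz
      ... | true  | true  | true  = K5-case N xy xz yz tx ty tz
      ... | true  | true  | false = K5-e-case N xy xz yz tx ty tz
      ... | true  | false | true  = K5-e-case (swap₂₃ N) xz xy (adj-sym yz) tx tz ty
      ... | false | true  | true  = K5-e-case (swap₂₃ (swap₁₂ N)) yz (adj-sym xy) (adj-sym xz) ty tz tx
      ... | true  | false | false = ⊥-elim (noSingleEdge N xy xz tx ty tz)
      ... | false | true  | false = ⊥-elim (noSingleEdge (swap₁₂ N) (adj-sym xy) yz ty tx tz)
      ... | false | false | true  = ⊥-elim (noSingleEdge (swap₁₂ (swap₂₃ N)) (adj-sym xz) (adj-sym yz) tz tx ty)
      ... | false | false | false = isolated-case N xy xz yz tx ty tz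

mainTheorem7 : (n : ℕ) (G : Graph n) → IsSimple G → FourRegular G →
    Irreducible G → ObtainedFromBlocks G
mainTheorem7 n G simple regular irreducible = Partition.obtainedFromBlocks (Irreducible.blockThrough irreducible)
  where open FourRegularGraph G simple regular
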